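{- Let $m\ge1,n\ge0$ and let $(R,T)\in\mathfrak{A\!C}_{m,n}^{\bullet}$. Let $k_1$ be the minimal index $k\in\{1,\dots,n\}$ such that $(a_j,c_k)\in R$ for some $j$ (with $k_1=n+1$ if $R=\emptyset$), and let $k_2$ be the maximal index $k\in\{1,\dots,n\}$ such that $(c_k,a_j)\in T$ for some $j$ (with $k_2=0$ if $T=\emptyset$). Then $k_1>k_2$. Consequently, writing $\mathfrak{A\!C}_{m,n}^{\bullet}(k_1,k_2)$ for the set of proper mergings with these parameters, \[ \mathfrak{A\!C}_{m,n}^{\bullet}=\biguplus_{k_1=1}^{n+1}\biguplus_{k_2=0}^{k_1-1}\mathfrak{A\!C}_{m,n}^{\bullet}(k_1,k_2). \]
   Context: For posets $(P,\le_P)$, $(Q,\le_Q)$ on disjoint ground sets and $R\subseteq P\times Q$, $T\subseteq Q\times P$, define $\le_{R,T}$ on $P\cup Q$ by: $x\le_{R,T}y$ iff $x\le_P y$, or $x\le_Q y$, or $(x,y)\in R$, or $(x,y)\in T$. $(R,T)$ is a merging if $\le_{R,T}$ is reflexive and transitive, and a proper merging if moreover $R\cap T^{ -1}=\emptyset$. The $m$-antichain is the poset on $A=\{a_1,\dots,a_m\}$ with only trivial relations; the $n$-chain is the poset on $C=\{c_1,\dots,c_n\}$ with $c_i\le c_j$ iff $i\le j$. $\mathfrak{A\!C}_{m,n}^{\bullet}$ is the set of proper mergings $(R,T)$, $R\subseteq A\times C$, $T\subseteq C\times A$, of the $m$-antichain and the $n$-chain. $\biguplus$ denotes disjoint union.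 -}

module Defs where

open import Data.Nat using (ℕ; zero; suc)
open import Data.Fin using (Fin; zero; suc; fromℕ; inject₁) renaming (_≤_ to _≤ᶠ_)
open import Data.Bool using (Bool; true; false; if_then_else_; _∨_)
open import Data.Sum using (_⊎_; inj₁; inj₂)
open import Data.Product using (_×_)
open import Relation.Binary.PropositionalEquality using (_≡_)
open import Relation.Nullary using (¬_)

-- Ground sets: the m-antichain A = {a_1..a_m} is Fin m (a_{j+1} ↔ j),
-- the n-chain C = {c_1..c_n} is Fin n (c_{k+1} ↔ k), ordered by Fin's ≤.
RelAC : ℕ → ℕ → Set
RelAC m n = Fin m → Fin n → Bool

RelCA : ℕ → ℕ → Set
RelCA m n = Fin n → Fin m → Bool

_≤[_,_]_ : ∀ {m n} → Fin m ⊎ Fin n → RelAC m n → RelCA m n → Fin m ⊎ Fin n → Set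
inj₁ a ≤[ R , T ] inj₁ a' = a ≡ a'
inj₂ c ≤[ R , T ] inj₂ c' = c ≤ᶠ c'
inj₁ a ≤[ R , T ] inj₂ c  = R a c ≡ true
inj₂ c ≤[ R , T ] inj₁ a  = T c a ≡ true

IsMerging : ∀ {m n} → RelAC m n → RelCA m n → Set
IsMerging {m} {n} R T =
  ((x : Fin m ⊎ Fin n) → x ≤[ R , T ] x) ×
  ((x y z : Fin m ⊎ Fin n) → x ≤[ R , T ] y → y ≤[ R , T ] z → x ≤[ R , T ] z)

IsProperMerging : ∀ {m n} → RelAC m n → RelCA m n → Set
IsProperMerging {m} {n} R T =
  IsMerging R T × ((a : Fin m) (c : Fin n) → ¬ (R a c ≡ true × T c a ≡ true))

anyFin : ∀ {m} → (Fin m → Bool) → Bool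
anyFin {zero} p = false
anyFin {suc m} p = p zero ∨ anyFin (λ j → p (suc j))

-- 1-based index of the first k with p k, or n+1 if none
firstIdx : ∀ {n} → (Fin n → Bool) → ℕ
firstIdx {zero} p = 1
firstIdx {suc n} p = if p zero then 1 else suc (firstIdx (λ k → p (suc k)))

-- 1-based index of the last k with p k, or 0 if none
lastIdx : ∀ {n} → (Fin n → Bool) → ℕ
lastIdx {zero} p = 0
lastIdx {suc n} p = if p (fromℕ n) then suc n else lastIdx (λ k → p (inject₁ k))

k₁ : ∀ {m n} → RelAC m n → ℕ
k₁ R = firstIdx (λ k → anyFin (λ j → R j k))

k₂ : ∀ {m n} → RelCA m n → ℕ
k₂ T = lastIdx (λ k → anyFin (λ j → T k j))

module Submission where

--  * The merging argument: in a proper merging, (c , a) ∈ T and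
--    (a' , c') ∈ R force c < c'.  Otherwise c' ≤ c, so transitivity gives
--    a' ≤ c' ≤ c ≤ a, hence a' = a (antichain) and a ≤ c ≤ a, i.e. both
--    (a , c) ∈ R and (c , a) ∈ T, contradicting properness.

open import Defs
open import Data.Nat using (ℕ; zero; suc; _≤_; _<_; s≤s; z≤n)
open import Data.Nat.Properties using (≤-refl; ≮⇒≥)
open import Data.Product using (_×_; _,_; ∃)
open import Data.Sum using (_⊎_; inj₁; inj₂)
open import Data.Fin using (Fin; toℕ; fromℕ; inject₁; _<?_) renaming (zero to fzero; suc to fsuc)
open import Data.Fin.Properties using (toℕ-fromℕ; toℕ-inject₁; toℕ<n)
open import Data.Bool using (Bool; true; false)
open import Relation.Binary.PropositionalEquality using (_≡_; refl; sym; trans; cong; subst; subst₂)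
open import Relation.Nullary using (yes; no; contradiction)

anyFin-witness : ∀ {m} (p : Fin m → Bool) → anyFin p ≡ true → ∃ λ j → p j ≡ true
anyFin-witness {zero} p ()
anyFin-witness {suc m} p any-p with p fzero in p0
... | true = fzero , p0
... | false with anyFin-witness (λ j → p (fsuc j)) any-p
...   | j , pj = fsuc j , pj

firstIdx-≥1 : ∀ {n} (p : Fin n → Bool) → 1 ≤ firstIdx p
firstIdx-≥1 {zero} p = s≤s z≤n
firstIdx-≥1 {suc n} p with p fzero
... | true = s≤s z≤n
... | false = s≤s z≤n

firstIdx-≤ : ∀ {n} (p : Fin n → Bool) → firstIdx p ≤ suc n
firstIdx-≤ {zero} p = ≤-refl
firstIdx-≤ {suc n} p with p fzero
... | true = s≤s z≤n
... | false = s≤s (firstIdx-≤ (λ k → p (fsuc k)))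

firstIdx-attained : ∀ {n} (p : Fin n → Bool) →
  firstIdx p ≡ suc n ⊎ (∃ λ k → p k ≡ true × firstIdx p ≡ suc (toℕ k))
firstIdx-attained {zero} p = inj₁ refl
firstIdx-attained {suc n} p with p fzero in p0
... | true = inj₂ (fzero , p0 , refl)
... | false with firstIdx-attained (λ k → p (fsuc k))
...   | inj₁ default = inj₁ (cong suc default)
...   | inj₂ (k , pk , at-k) = inj₂ (fsuc k , pk , cong suc at-k)

lastIdx-attained : ∀ {n} (p : Fin n → Bool) →
  lastIdx p ≡ 0 ⊎ (∃ λ k → p k ≡ true × lastIdx p ≡ suc (toℕ k))
lastIdx-attained {zero} p = inj₁ refl
lastIdx-attained {suc n} p with p (fromℕ n) in pn
... | true = inj₂ (fromℕ n , pn , cong suc (sym (toℕ-fromℕ n)))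
... | false with lastIdx-attained (λ k → p (inject₁ k))
...   | inj₁ default = inj₁ default
...   | inj₂ (k , pk , at-k) =
        inj₂ (inject₁ k , pk , trans at-k (cong suc (sym (toℕ-inject₁ k))))

lastIdx<firstIdx : ∀ {n} (q p : Fin n → Bool) →
  (∀ k k' → q k ≡ true → p k' ≡ true → toℕ k < toℕ k') →
  lastIdx q < firstIdx p
lastIdx<firstIdx q p separated with lastIdx-attained q
... | inj₁ last≡0 = subst (_< firstIdx p) (sym last≡0) (firstIdx-≥1 p)
... | inj₂ (k , qk , last≡k) with firstIdx-attained p
...   | inj₁ first≡n+1 =
        subst₂ _<_ (sym last≡k) (sym first≡n+1) (s≤s (toℕ<n k))
...   | inj₂ (k' , pk' , first≡k') =
        subst₂ _<_ (sym last≡k) (sym first≡k') (s≤s (separated k k' qk pk'))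

T-below-R : ∀ {m n} {R : RelAC m n} {T : RelCA m n} → IsProperMerging R T →
  ∀ {a a' c c'} → T c a ≡ true → R a' c' ≡ true → toℕ c < toℕ c'
T-below-R {R = R} ((_ , trans≤) , proper) {a} {a'} {c} {c'} Tca Ra'c' with c <? c'
... | yes c<c' = c<c'
... | no c≮c' = contradiction (Rac , Tca) (proper a c)
  where
  Ra'c : R a' c ≡ true
  Ra'c = trans≤ (inj₁ a') (inj₂ c') (inj₂ c) Ra'c' (≮⇒≥ c≮c')
  a'≡a : a' ≡ a
  a'≡a = trans≤ (inj₁ a') (inj₂ c) (inj₁ a) Ra'c Tca
  Rac : R a c ≡ true
  Rac = subst (λ x → R x c ≡ true) a'≡a Ra'c

lemma4p1 : (m n : ℕ) → 1 ≤ m → (R : RelAC m n) (T : RelCA m n) →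
    IsProperMerging R T →
    (1 ≤ k₁ R × k₁ R ≤ suc n) × k₂ T < k₁ R
lemma4p1 m n _ R T proper =
  (firstIdx-≥1 P , firstIdx-≤ P) , lastIdx<firstIdx Q P separated
  where
  P Q : Fin n → Bool
  P k = anyFin (λ j → R j k)
  Q k = anyFin (λ j → T k j)
  separated : ∀ k k' → Q k ≡ true → P k' ≡ true → toℕ k < toℕ k'
  separated k k' Qk Pk' with anyFin-witness (T k) Qk | anyFin-witness (λ j → R j k') Pk'
  ... | _ , Tka | _ , Ra'k' = T-below-R proper Tka Ra'k'
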